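{- Let $\pi$ be a Baxter permutation of $[n]$ and write $\Psi(\pi)=(P_b,P_m,P_t)$ (bottom, middle, top path). Then (1) for each $i\in[n-1]$, the $i$-th step of $P_b$ is horizontal iff $i\in\mathrm{DB}(\pi)$; (2) the $i$-th step of $P_m$ is horizontal iff $i\in\mathrm{IDES}(\pi)$; (3) the $i$-th step of $P_t$ is horizontal iff $i\in\widehat{\mathrm{DT}}(\pi)$.
   Context: A permutation $\pi=\pi_1\cdots\pi_n$ of $[n]$ is Baxter if there are no indices $1\le i<j<j+1<k\le n$ with $\pi_{j+1}<\pi_i<\pi_k<\pi_j$ or $\pi_j<\pi_k<\pi_i<\pi_{j+1}$. Set $\mathrm{DT}(\pi)=\{\pi_i:\pi_i>\pi_{i+1}\}$, $\mathrm{DB}(\pi)=\{\pi_{i+1}:\pi_i>\pi_{i+1}\}$, $\mathrm{IDES}(\pi)=\{i\in[n-1]:\ i+1 \text{ appears before } i \text{ in } \pi\}$, and $\widehat{\mathrm{DT}}(\pi)=(\mathrm{DT}(\pi)\cup\{\pi_n\})\setminus\{n\}$. Fran\c{c}on--Viennot map: with the convention $\pi_0=\pi_{n+1}=0$, a value $v=\pi_p$ is a valley if $\pi_{p-1}>\pi_p<\pi_{p+1}$, a peak if $\pi_{p-1}<\pi_p>\pi_{p+1}$, a double descent if $\pi_{p-1}>\pi_p>\pi_{p+1}$, a double ascent if $\pi_{p-1}<\pi_p<\pi_{p+1}$. Define $\psi_{FV}(\pi)=(w,\mu)$ with $w=w_1\cdots w_{n-1}$ a word where $w_i=U$ if $i$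 is a valley, $D$ if $i$ is a peak, $H_b$ if $i$ is a double descent, $H_r$ if $i$ is a double ascent; and $\mu_i=1+\#\{p: p<p_i,\ \pi_p<i<\pi_{p-1}\}$ where $p_i$ is the position of $i$ in $\pi$ (for $1\le i\le n-1$). The map $\Psi$: $\Psi(\pi)=(P_b,P_m,P_t)$ is a triple of lattice paths with $n-1$ unit steps each (steps $(1,0)$ horizontal or $(0,1)$ vertical), where $P_t$ starts at $(0,2)$ and $P_b$ starts at $(2,0)$, and for each $i\in[n-1]$ the $i$-th step of $P_t$ (resp. $P_b$) is vertical (resp. horizontal) if $w_i=U$; horizontal (resp. vertical) if $w_i=D$; vertical (resp. vertical) if $w_i=H_r$; horizontal (resp. horizontal) if $w_i=H_b$. The middle path $P_m$ is the lattice path whose $i$-th step starts at $(x_i-\mu_i,y_i+\mu_i)$ for $1\le i\le n-1$, where $(x_i,y_i)$ is the starting point of the $i$-th step of $P_b$, and which ends at $(x_n-1,y_n+1)$, where $(x_n,y_n)$ is the endpoint of $P_b$. (For Baxter $\pi$ this gives a triple of non-intersecting lattice paths from $(0,2),(1,1),(2,0)$.) -}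

module Defs where

open import Data.Nat using (ℕ; zero; suc; _∸_; _≤_; _<_; _<ᵇ_; _≡ᵇ_)
open import Data.Integer using (ℤ; +_; -[1+_]) renaming (_+_ to _+ℤ_; -_ to -ℤ_)
open import Data.Bool using (Bool; true; false; if_then_else_; _∧_)
open import Data.List using (List; []; _∷_; map; upTo)
open import Data.Nat.ListAction using (sum)
open import Data.List.Relation.Binary.Permutation.Propositional using (_↭_)
open import Data.Product using (_×_; _,_; ∃)
open import Data.Sum using (_⊎_)
open import Relation.Binary.PropositionalEquality using (_≡_; _≢_)
open import Relation.Nullary using (¬_)

IsPerm : ℕ → List ℕ → Set
IsPerm n π = π ↭ map suc (upTo n)

-- at π p = π_p (1-based), with the convention π_0 = π_{n+1} = 0
-- (and 0 beyond the end as well).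
at : List ℕ → ℕ → ℕ
at _ zero = 0
at [] (suc _) = 0
at (x ∷ _) (suc zero) = x
at (_ ∷ xs) (suc (suc p)) = at xs (suc p)

-- pos π v = 1-based position of the value v in π.
pos : List ℕ → ℕ → ℕ
pos [] v = 0
pos (x ∷ xs) v = if x ≡ᵇ v then 1 else suc (pos xs v)

Baxter : ℕ → List ℕ → Set
Baxter n π = ∀ i j k → 1 ≤ i → i < j → suc j < k → k ≤ n →
  ¬ ((at π (suc j) < at π i × at π i < at π k × at π k < at π j)
     ⊎ (at π j < at π k × at π k < at π i × at π i < at π (suc j)))

DT : ℕ → List ℕ → ℕ → Set
DT n π v = ∃ λ i → 1 ≤ i × i < n × at π (suc i) < at π i × at π i ≡ v

DB : ℕ → List ℕ → ℕ → Set
DB n π v = ∃ λ i → 1 ≤ i × i < n × at π (suc i) < at π i × at π (suc i) ≡ v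

IDES : ℕ → List ℕ → ℕ → Set
IDES n π i = 1 ≤ i × i < n × pos π (suc i) < pos π i

DThat : ℕ → List ℕ → ℕ → Set
DThat n π v = (DT n π v ⊎ v ≡ at π n) × v ≢ n

data Letter : Set where
  U D Hb Hr : Letter

-- w_i : classify the value i according to its neighbours in π
-- (with π_0 = π_{n+1} = 0).  U = valley, D = peak,
-- Hb = double descent, Hr = double ascent.
letter : List ℕ → ℕ → Letter
letter π i with i <ᵇ at π (pos π i ∸ 1) | i <ᵇ at π (suc (pos π i))
... | true  | true  = U
... | true  | false = Hb
... | false | true  = Hr
... | false | false = D

mu : List ℕ → ℕ → ℕ
mu π i = suc (sum (map (λ p → if (at π p <ᵇ i) ∧ (i <ᵇ at π (p ∸ 1)) then 1 else 0)
                       (map suc (upTo (pos π i ∸ 1)))))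

data Step : Set where
  H V : Step

Point : Set
Point = ℤ × ℤ

move : Point → Step → Point
move (x , y) H = (x +ℤ + 1 , y)
move (x , y) V = (x , y +ℤ + 1)

shift : Point → ℤ → ℤ → Point
shift (x , y) a b = (x +ℤ a , y +ℤ b)

bStep : Letter → Step
bStep U  = H
bStep D  = V
bStep Hr = V
bStep Hb = H

tStep : Letter → Step
tStep U  = V
tStep D  = H
tStep Hr = V
tStep Hb = H

-- vertices of P_b: bVert π k = endpoint of the k-th step
-- (bVert π 0 = (2,0) the starting point); the i-th step goes from
-- bVert π (i-1) to bVert π i.
bVert : List ℕ → ℕ → Point
bVert π zero = (+ 2 , + 0)
bVert π (suc k) = move (bVert π k) (bStep (letter π (suc k)))

tVert : List ℕ → ℕ → Point
tVert π zero = (+ 0 , + 2)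
tVert π (suc k) = move (tVert π k) (tStep (letter π (suc k)))

-- vertices of P_m: mVert n π (i-1) is the starting point of the i-th
-- step, namely (x_i - μ_i , y_i + μ_i) for 1 ≤ i ≤ n-1, and
-- mVert n π (n-1) = (x_n - 1 , y_n + 1) is the endpoint.
mVert : ℕ → List ℕ → ℕ → Point
mVert n π k = if suc k <ᵇ n
  then shift (bVert π k) (-ℤ (+ mu π (suc k))) (+ mu π (suc k))
  else shift (bVert π (n ∸ 1)) (-[1+ 0 ]) (+ 1)

HorizStep : (ℕ → Point) → ℕ → Set
HorizStep v i = v i ≡ move (v (i ∸ 1)) H

-- Whether the i-th step of P_b (resp. P_t) is horizontal only depends on
-- whether the value just before (resp. after) i in π exceeds i, and this is
-- how DB and DT^ are read off.  Let p, p' be the positions of i and i+1, and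
-- recall that μ_t - 1 counts the descents π_{q-1} > t > π_q with q before t.
-- The i-th step of P_m is horizontal iff μ_i = h + μ_{i+1}, where
-- h = [π_{p-1} < i] is the height of the i-th step of P_b.  Before min(p, p')
-- a descent straddles i iff it straddles i+1.  If p' < p, the Baxter condition
-- (no 3-14-2) forces the values between p' and p, once below i, to stay below
-- i, so one more descent straddles i when π_{p-1} < i and none otherwise:
-- μ_i = h + μ_{i+1}.  If p < p', it (no 2-41-3) forbids descents straddling
-- i+1 strictly between p and p', so μ_{i+1} = [π_{p-1} > i] + μ_i, and
-- μ_i = h + μ_{i+1} would force μ_i = 1 + μ_i.
module Submission where

open import Defs
open import Algebra.Bundles using (AbelianGroup)
open import Data.Bool using (Bool; true; false; if_then_else_; _∧_; not; T)
open import Data.Bool.Properties using (∧-identityʳ; ∧-zeroʳ)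
open import Data.Integer using (+_) renaming (_+_ to _+ℤ_; -_ to -ℤ_)
import Data.Integer.Properties as ℤ
open import Data.Integer.Tactic.RingSolver using (solve-∀)
open import Data.List using (List; []; _∷_; map; upTo; length; _++_; [_])
open import Data.List.Properties using (length-map; length-upTo; upTo-∷ʳ; map-++)
open import Data.List.Membership.Propositional using (_∈_)
open import Data.List.Membership.Propositional.Properties using (∈-map⁺; ∈-map⁻; ∈-upTo⁺; ∈-upTo⁻)
open import Data.List.Relation.Unary.Any using (here; there)
open import Data.List.Relation.Unary.All using (lookup)
open import Data.List.Relation.Unary.AllPairs using (_∷_)
open import Data.List.Relation.Unary.Unique.Propositional using (Unique)
import Data.List.Relation.Unary.Unique.Propositional.Properties as Unique
open import Data.List.Relation.Binary.Permutation.Propositional using (↭-sym; ↭⇒↭ₛ)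
open import Data.List.Relation.Binary.Permutation.Propositional.Properties using (∈-resp-↭; ↭-length)
import Data.List.Relation.Binary.Permutation.Setoid.Properties as SetoidPermutation
open import Data.Nat using (ℕ; zero; suc; _+_; _∸_; _≤_; _<_; _<ᵇ_; _≡ᵇ_; z≤n; s≤s)
open import Data.Nat.Properties
open import Data.Nat.ListAction using (sum)
open import Data.Nat.ListAction.Properties using (sum-++)
open import Data.Product using (_×_; _,_; proj₂; ∃)
open import Data.Sum using (_⊎_; inj₁; inj₂)
open import Function.Bundles using (_⇔_; mk⇔)
open import Function.Construct.Composition using (_⇔-∘_)
open import Relation.Binary.Definitions using (tri<; tri≈; tri>)
open import Relation.Binary.PropositionalEquality hiding ([_])
open import Relation.Nullary using (¬_; yes; no; contradiction)
open import Relation.Nullary.Reflects using (Reflects; ofʸ; ofⁿ)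
open import Algebra.Properties.Group (AbelianGroup.group ℤ.+-0-abelianGroup) using (∙-cancelˡ)

≡ᵇ-true : ∀ {m n} → m ≡ n → (m ≡ᵇ n) ≡ true
≡ᵇ-true {zero} refl = refl
≡ᵇ-true {suc m} refl = ≡ᵇ-true {m} refl

≡ᵇ-false : ∀ {m n} → m ≢ n → (m ≡ᵇ n) ≡ false
≡ᵇ-false {m} {n} m≢n with m ≡ᵇ n in eq
... | false = refl
... | true  = contradiction (≡ᵇ⇒≡ m n (subst T (sym eq) _)) m≢n

<ᵇ-true : ∀ {m n} → m < n → (m <ᵇ n) ≡ true
<ᵇ-true {zero} (s≤s _) = refl
<ᵇ-true {suc m} (s≤s m<n) = <ᵇ-true m<n

<ᵇ-false : ∀ {m n} → n ≤ m → (m <ᵇ n) ≡ false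
<ᵇ-false {n = zero} _ = refl
<ᵇ-false {suc m} {suc n} (s≤s n≤m) = <ᵇ-false n≤m

<ᵇ-false⇒≥ : ∀ {m n} → (m <ᵇ n) ≡ false → n ≤ m
<ᵇ-false⇒≥ eq = ≮⇒≥ (λ m<n → subst T eq (<⇒<ᵇ m<n))

<ᵇ-sucʳ : ∀ {a t} → a ≢ t → (a <ᵇ t) ≡ (a <ᵇ suc t)
<ᵇ-sucʳ {zero} {zero} a≢t = contradiction refl a≢t
<ᵇ-sucʳ {zero} {suc t} _ = refl
<ᵇ-sucʳ {suc a} {zero} _ = refl
<ᵇ-sucʳ {suc a} {suc t} a≢t = <ᵇ-sucʳ (λ e → a≢t (cong suc e))

<ᵇ-sucˡ : ∀ {t x} → x ≢ suc t → (t <ᵇ x) ≡ (suc t <ᵇ x)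
<ᵇ-sucˡ {t} {zero} _ = refl
<ᵇ-sucˡ {zero} {suc zero} x≢1 = contradiction refl x≢1
<ᵇ-sucˡ {zero} {suc (suc x)} _ = refl
<ᵇ-sucˡ {suc t} {suc x} x≢t = <ᵇ-sucˡ (λ e → x≢t (cong suc e))

indicator : Bool → ℕ
indicator b = if b then 1 else 0

not-<ᵇ : ∀ {x t} → x ≢ t → not (t <ᵇ x) ≡ (x <ᵇ t)
not-<ᵇ {x} {t} x≢t with <-cmp x t
... | tri< x<t _ _ rewrite <ᵇ-false (<⇒≤ x<t) | <ᵇ-true x<t = refl
... | tri≈ _ x≡t _ = contradiction x≡t x≢t
... | tri> _ _ t<x rewrite <ᵇ-true t<x | <ᵇ-false (<⇒≤ t<x) = refl

indicator-trichotomy : ∀ {x t} → x ≢ t → indicator (x <ᵇ t) + indicator (t <ᵇ x) ≡ 1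
indicator-trichotomy {x} {t} x≢t with <-cmp x t
... | tri< x<t _ _ rewrite <ᵇ-false (<⇒≤ x<t) | <ᵇ-true x<t = refl
... | tri≈ _ x≡t _ = contradiction x≡t x≢t
... | tri> _ _ t<x rewrite <ᵇ-true t<x | <ᵇ-false (<⇒≤ t<x) = refl

pos-∈ : ∀ xs {v} → v ∈ xs → 1 ≤ pos xs v × pos xs v ≤ length xs × at xs (pos xs v) ≡ v
pos-∈ (x ∷ xs) {v} v∈ with x ≡ᵇ v in eq
... | true = s≤s z≤n , s≤s z≤n , ≡ᵇ⇒≡ x v (subst T (sym eq) _)
pos-∈ (x ∷ xs) (here refl) | false with () ← trans (sym (≡ᵇ-true {x} refl)) eq
pos-∈ (x ∷ xs) {v} (there v∈) | false with pos xs v | pos-∈ xs v∈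
... | suc _ | _ , le , at≡v = s≤s z≤n , s≤s le , at≡v

at-∈ : ∀ xs {q} → 1 ≤ q → q ≤ length xs → at xs q ∈ xs
at-∈ (x ∷ xs) {suc zero} _ _ = here refl
at-∈ (x ∷ xs) {suc (suc q)} _ (s≤s q<len) = there (at-∈ xs (s≤s z≤n) q<len)

at-beyond : ∀ xs {q} → length xs < q → at xs q ≡ 0
at-beyond [] {suc q} _ = refl
at-beyond (x ∷ xs) {suc (suc q)} (s≤s len<q) = at-beyond xs len<q

pos-at : ∀ {xs} → Unique xs → ∀ {q} → 1 ≤ q → q ≤ length xs → pos xs (at xs q) ≡ q
pos-at {x ∷ xs} _ {suc zero} _ _ rewrite ≡ᵇ-true {x} refl = refl
pos-at {x ∷ xs} (x∉xs ∷ xs!) {suc (suc q)} _ (s≤s q<len)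
  rewrite ≡ᵇ-false (lookup x∉xs (at-∈ xs (s≤s z≤n) q<len))
  = cong suc (pos-at xs! (s≤s z≤n) q<len)

at-positive⇒1≤ : ∀ {xs q m} → m < at xs q → 1 ≤ q
at-positive⇒1≤ {q = suc _} _ = s≤s z≤n

sumTo : (ℕ → ℕ) → ℕ → ℕ
sumTo g zero = 0
sumTo g (suc m) = sumTo g m + g (suc m)

sum-map-upTo : ∀ g m → sum (map g (map suc (upTo m))) ≡ sumTo g m
sum-map-upTo g zero = refl
sum-map-upTo g (suc m) = begin
  sum (map g (map suc (upTo (suc m))))
    ≡⟨ cong (λ l → sum (map g (map suc l))) (sym (upTo-∷ʳ m)) ⟩
  sum (map g (map suc (upTo m ++ [ m ])))
    ≡⟨ cong (λ l → sum (map g l)) (map-++ suc (upTo m) [ m ]) ⟩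
  sum (map g (map suc (upTo m) ++ [ suc m ]))
    ≡⟨ cong sum (map-++ g (map suc (upTo m)) [ suc m ]) ⟩
  sum (map g (map suc (upTo m)) ++ [ g (suc m) ])
    ≡⟨ sum-++ (map g (map suc (upTo m))) [ g (suc m) ] ⟩
  sum (map g (map suc (upTo m))) + (g (suc m) + 0)
    ≡⟨ cong₂ _+_ (sum-map-upTo g m) (+-identityʳ _) ⟩
  sumTo g m + g (suc m) ∎
  where open ≡-Reasoning

straddles : List ℕ → ℕ → ℕ → Bool
straddles π t q = (at π q <ᵇ t) ∧ (t <ᵇ at π (q ∸ 1))

crossings : List ℕ → ℕ → ℕ → ℕ
crossings π t = sumTo (λ q → indicator (straddles π t q))

module _ {π : List ℕ} where

  mu≡ : ∀ t → mu π t ≡ suc (crossings π t (pos π t ∸ 1))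
  mu≡ t = cong suc (sum-map-upTo _ (pos π t ∸ 1))

  straddles-above : ∀ {t q} → t < at π (q ∸ 1) → straddles π t q ≡ (at π q <ᵇ t)
  straddles-above {t} {q} t<prev rewrite <ᵇ-true t<prev = ∧-identityʳ (at π q <ᵇ t)

  straddles-below : ∀ {t q} → at π (q ∸ 1) ≤ t → straddles π t q ≡ false
  straddles-below {t} {q} prev≤t rewrite <ᵇ-false prev≤t = ∧-zeroʳ (at π q <ᵇ t)

  straddles-suc : ∀ {t q} → at π q ≢ t → at π (q ∸ 1) ≢ suc t → straddles π t q ≡ straddles π (suc t) q
  straddles-suc cur≢t prev≢1+t = cong₂ _∧_ (<ᵇ-sucʳ cur≢t) (<ᵇ-sucˡ prev≢1+t)

  crossings-suc : ∀ {t} m → (∀ {q} → q ≤ m → at π q ≢ t) → (∀ {q} → q < m → at π q ≢ suc t) →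
                  crossings π t m ≡ crossings π (suc t) m
  crossings-suc zero _ _ = refl
  crossings-suc (suc m) ≢t ≢1+t =
    cong₂ _+_ (crossings-suc m (λ q≤m → ≢t (m≤n⇒m≤1+n q≤m)) (λ q<m → ≢1+t (m<n⇒m<1+n q<m)))
              (cong indicator (straddles-suc {q = suc m} (≢t ≤-refl) (≢1+t ≤-refl)))

  crossings-of-max : ∀ {t} → (∀ q → at π q ≤ t) → ∀ m → crossings π t m ≡ 0
  crossings-of-max _ zero = refl
  crossings-of-max ≤t (suc m) =
    cong₂ _+_ (crossings-of-max ≤t m) (cong indicator (straddles-below {q = suc m} (≤t m)))

height : Step → ℕ
height H = 0
height V = 1

vertical≢horizontal : ∀ p → move p V ≢ move p H
vertical≢horizontal (x , y) e
  with () ← ∙-cancelˡ y (+ 1) (+ 0) (trans (cong proj₂ e) (sym (ℤ.+-identityʳ y)))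

horizontal-if⇔ : ∀ {P : Set} {b p} → Reflects P b → (move p (if b then H else V) ≡ move p H) ⇔ P
horizontal-if⇔ (ofʸ x) = mk⇔ (λ _ → x) (λ _ → refl)
horizontal-if⇔ {p = p} (ofⁿ ¬x) = mk⇔ (λ e → contradiction e (vertical≢horizontal p)) (λ x → contradiction x ¬x)

vertical-if⇔ : ∀ {P : Set} {b p} → Reflects P b → (move p (if b then V else H) ≡ move p H) ⇔ (¬ P)
vertical-if⇔ {p = p} (ofʸ x) = mk⇔ (λ e → contradiction e (vertical≢horizontal p)) (λ ¬x → contradiction x ¬x)
vertical-if⇔ (ofⁿ ¬x) = mk⇔ (λ _ → ¬x) (λ _ → refl)

height-if : ∀ b → height (if b then H else V) ≡ indicator (not b)
height-if true = refl
height-if false = refl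

-- With p the start of the i-th step s of P_b, a = μ_i and b = μ_{i+1}, the
-- left-hand equation says that the i-th step of P_m is horizontal.
shifted-step⇔ : ∀ p s a b →
  (shift (move p s) (-ℤ (+ b)) (+ b) ≡ move (shift p (-ℤ (+ a)) (+ a)) H) ⇔ (a ≡ height s + b)
shifted-step⇔ (x , y) H a b = mk⇔
  (λ e → ℤ.+-injective (∙-cancelˡ y (+ a) (+ b) (sym (cong proj₂ e))))
  (λ { refl → cong (_, y +ℤ + a) (shuffle x (+ a)) })
  where
  shuffle : ∀ x c → (x +ℤ + 1) +ℤ -ℤ c ≡ (x +ℤ -ℤ c) +ℤ + 1
  shuffle = solve-∀
shifted-step⇔ (x , y) V a b = mk⇔
  (λ e → ℤ.+-injective (∙-cancelˡ y (+ a) (+ suc b) (sym (trans (sym (reassoc y (+ b))) (cong proj₂ e)))))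
  (λ { refl → cong₂ _,_ (shuffle x (+ b)) (reassoc y (+ b)) })
  where
  shuffle : ∀ x c → x +ℤ -ℤ c ≡ (x +ℤ -ℤ (+ 1 +ℤ c)) +ℤ + 1
  shuffle = solve-∀
  reassoc : ∀ y c → (y +ℤ + 1) +ℤ c ≡ y +ℤ (+ 1 +ℤ c)
  reassoc = solve-∀

bStep-letter : ∀ {π i p₀} → pos π i ≡ suc p₀ → bStep (letter π i) ≡ (if i <ᵇ at π p₀ then H else V)
bStep-letter {π} {i} pos≡ = trans classify (cong (λ q → if i <ᵇ at π (q ∸ 1) then H else V) pos≡)
  where
  classify : bStep (letter π i) ≡ (if i <ᵇ at π (pos π i ∸ 1) then H else V)
  classify with i <ᵇ at π (pos π i ∸ 1) | i <ᵇ at π (suc (pos π i))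
  ... | true  | true  = refl
  ... | true  | false = refl
  ... | false | true  = refl
  ... | false | false = refl

tStep-letter : ∀ {π i p₀} → pos π i ≡ suc p₀ → tStep (letter π i) ≡ (if i <ᵇ at π (suc (suc p₀)) then V else H)
tStep-letter {π} {i} pos≡ = trans classify (cong (λ q → if i <ᵇ at π (suc q) then V else H) pos≡)
  where
  classify : tStep (letter π i) ≡ (if i <ᵇ at π (suc (pos π i)) then V else H)
  classify with i <ᵇ at π (pos π i ∸ 1) | i <ᵇ at π (suc (pos π i))
  ... | true  | true  = refl
  ... | true  | false = refl
  ... | false | true  = refl
  ... | false | false = refl

bottom-step⇔ : ∀ {π k p₀} → pos π (suc k) ≡ suc p₀ → HorizStep (bVert π) (suc k) ⇔ suc k < at π p₀
bottom-step⇔ {π} {k} {p₀} pos≡ =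
  subst (λ s → (move (bVert π k) s ≡ move (bVert π k) H) ⇔ suc k < at π p₀)
        (sym (bStep-letter {π} pos≡)) (horizontal-if⇔ (<ᵇ-reflects-< (suc k) (at π p₀)))

top-step⇔ : ∀ {π k p₀} → pos π (suc k) ≡ suc p₀ → HorizStep (tVert π) (suc k) ⇔ (¬ suc k < at π (suc (suc p₀)))
top-step⇔ {π} {k} {p₀} pos≡ =
  subst (λ s → (move (tVert π k) s ≡ move (tVert π k) H) ⇔ (¬ suc k < at π (suc (suc p₀))))
        (sym (tStep-letter {π} pos≡)) (vertical-if⇔ (<ᵇ-reflects-< (suc k) (at π (suc (suc p₀)))))

module Permutation {n : ℕ} {π : List ℕ} (π-perm : IsPerm n π) where

  length≡n : length π ≡ n
  length≡n = trans (↭-length π-perm) (trans (length-map suc (upTo n)) (length-upTo n))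

  unique : Unique π
  unique = SetoidPermutation.Unique-resp-↭ (setoid ℕ) (↭⇒↭ₛ (↭-sym π-perm))
             (Unique.map⁺ suc-injective (Unique.upTo⁺ n))

  at-beyond-n : ∀ {q} → n < q → at π q ≡ 0
  at-beyond-n n<q = at-beyond π (subst (_< _) (sym length≡n) n<q)

  at≤n : ∀ q → at π q ≤ n
  at≤n zero = z≤n
  at≤n (suc q) with suc q ≤? n
  ... | no q≰n rewrite at-beyond-n (≰⇒> q≰n) = z≤n
  ... | yes q≤n with ∈-map⁻ suc (∈-resp-↭ π-perm (at-∈ π (s≤s z≤n) (subst (_ ≤_) (sym length≡n) q≤n)))
  ...   | _ , v∈ , at≡v rewrite at≡v = ∈-upTo⁻ v∈

  position≤n : ∀ {q} → 1 ≤ at π q → q ≤ n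
  position≤n {q} 1≤ with q ≤? n
  ... | yes q≤n = q≤n
  ... | no q≰n with () ← subst (1 ≤_) (at-beyond-n (≰⇒> q≰n)) 1≤

  occurs : ∀ {v} → 1 ≤ v → v ≤ n → ∃ λ p₀ → at π (suc p₀) ≡ v
  occurs {suc v} _ v≤n with pos π (suc v) | pos-∈ π (∈-resp-↭ (↭-sym π-perm) (∈-map⁺ suc (∈-upTo⁺ v≤n)))
  ... | suc p₀ | _ , _ , at≡v = p₀ , at≡v

  pos≡ : ∀ {v q} → 1 ≤ v → at π q ≡ v → pos π v ≡ q
  pos≡ {q = zero} () refl
  pos≡ {q = suc q} 1≤v refl = pos-at unique (s≤s z≤n) (subst (_ ≤_) (sym length≡n) (position≤n 1≤v))

  mu-n≡1 : mu π n ≡ 1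
  mu-n≡1 = trans (mu≡ {π} n) (cong suc (crossings-of-max at≤n (pos π n ∸ 1)))

  -- The endpoint (x_n - 1, y_n + 1) of P_m fits the general formula as μ_n = 1.
  mVert≡ : ∀ {k} → suc k ≤ n → mVert n π k ≡ shift (bVert π k) (-ℤ (+ mu π (suc k))) (+ mu π (suc k))
  mVert≡ {k} k<n with suc k <ᵇ n in eq
  ... | true = refl
  ... | false = cong₂ (λ j m → shift (bVert π j) (-ℤ (+ m)) (+ m))
                      (cong (_∸ 1) n≡1+k) (sym (subst (λ j → mu π j ≡ 1) n≡1+k mu-n≡1))
    where
    n≡1+k : n ≡ suc k
    n≡1+k = ≤-antisym (<ᵇ-false⇒≥ eq) k<n

  middle-step⇔ : ∀ {k} → suc (suc k) ≤ n →
    HorizStep (mVert n π) (suc k) ⇔ (mu π (suc k) ≡ height (bStep (letter π (suc k))) + mu π (suc (suc k)))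
  middle-step⇔ {k} 1+k<n =
    subst₂ (λ u w → (u ≡ w) ⇔ _) (sym (mVert≡ 1+k<n)) (sym (cong (λ z → move z H) (mVert≡ (<⇒≤ 1+k<n))))
           (shifted-step⇔ (bVert π k) (bStep (letter π (suc k))) (mu π (suc k)) (mu π (suc (suc k))))

  -- p₀ is the position of v minus one, so that no truncated subtraction occurs.
  module Occurrence {v p₀ : ℕ} (1≤v : 1 ≤ v) (π[p]≡v : at π (suc p₀) ≡ v) where

    pos≡p : pos π v ≡ suc p₀
    pos≡p = pos≡ 1≤v π[p]≡v

    only-at-p : ∀ {q} → at π q ≡ v → q ≡ suc p₀
    only-at-p π[q]≡v = trans (sym (pos≡ 1≤v π[q]≡v)) pos≡p

    p≤n : suc p₀ ≤ n
    p≤n = position≤n (subst (1 ≤_) (sym π[p]≡v) 1≤v)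

    prev-above⇔DB : v < at π p₀ ⇔ DB n π v
    prev-above⇔DB = mk⇔ from to
      where
      to : DB n π v → v < at π p₀
      to (j , _ , _ , descent , π[j+1]≡v) =
        subst₂ (λ u q → u < at π q) π[j+1]≡v (suc-injective (only-at-p π[j+1]≡v)) descent
      from : v < at π p₀ → DB n π v
      from v<prev = p₀ , at-positive⇒1≤ v<prev , p≤n , subst (_< at π p₀) (sym π[p]≡v) v<prev , π[p]≡v

    next-not-above⇔DThat : v < n → (¬ v < at π (suc (suc p₀))) ⇔ DThat n π v
    next-not-above⇔DThat v<n = mk⇔ from to
      where
      to : DThat n π v → ¬ v < at π (suc (suc p₀))
      to (inj₁ (j , _ , _ , descent , π[j]≡v) , _) =
        <-asym (subst₂ (λ q u → at π (suc q) < u) (only-at-p π[j]≡v) π[j]≡v descent)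
      to (inj₂ v≡π[n] , _) v<next = n≮0 (subst (v <_) next≡0 v<next)
        where
        next≡0 : at π (suc (suc p₀)) ≡ 0
        next≡0 = subst (λ q → at π (suc q) ≡ 0) (only-at-p {n} (sym v≡π[n])) (at-beyond-n (n<1+n n))
      from : ¬ v < at π (suc (suc p₀)) → DThat n π v
      from ¬v<next = last-or-descent , <⇒≢ v<n
        where
        next<v : at π (suc (suc p₀)) < v
        next<v = ≤∧≢⇒< (≮⇒≥ ¬v<next) (λ e → 1+n≢n (only-at-p e))
        last-or-descent : DT n π v ⊎ v ≡ at π n
        last-or-descent with suc p₀ <? n
        ... | yes p<n = inj₁ (suc p₀ , s≤s z≤n , p<n , subst (_ <_) (sym π[p]≡v) next<v , π[p]≡v)
        ... | no p≮n = inj₂ (trans (sym π[p]≡v) (cong (at π) (≤-antisym p≤n (≮⇒≥ p≮n))))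

module BaxterPermutation {n : ℕ} {π : List ℕ} (π-perm : IsPerm n π) (π-baxter : Baxter n π) where

  open Permutation π-perm

  module Adjacent {i p₀ p₀' : ℕ} (1≤i : 1 ≤ i) (π[p]≡i : at π (suc p₀) ≡ i) (π[p']≡1+i : at π (suc p₀') ≡ suc i) where

    open Occurrence 1≤i π[p]≡i using (only-at-p; p≤n; pos≡p)
    open Occurrence (s≤s z≤n) π[p']≡1+i using () renaming (only-at-p to only-at-p'; p≤n to p'≤n; pos≡p to pos≡p')

    π[p]<π[p'] : at π (suc p₀) < at π (suc p₀')
    π[p]<π[p'] = subst₂ _<_ (sym π[p]≡i) (sym π[p']≡1+i) (n<1+n i)

    i-not-before : ∀ {q} → q ≤ p₀ → at π q ≢ i
    i-not-before q≤p₀ π[q]≡i = <⇒≢ (s≤s q≤p₀) (only-at-p π[q]≡i)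

    1+i-not-before : ∀ {q} → q ≤ p₀' → at π q ≢ suc i
    1+i-not-before q≤p₀' π[q]≡1+i = <⇒≢ (s≤s q≤p₀') (only-at-p' π[q]≡1+i)

    i-not-after : ∀ {q} → suc p₀ < q → at π q ≢ i
    i-not-after p<q π[q]≡i = <⇒≢ p<q (sym (only-at-p π[q]≡i))

    1+i-not-after : ∀ {q} → suc p₀' < q → at π q ≢ suc i
    1+i-not-after p'<q π[q]≡1+i = <⇒≢ p'<q (sym (only-at-p' π[q]≡1+i))

    -- Otherwise π_r < i < i+1 < π_{r+1}, with i+1 at p' and i at p, is a 3-14-2.
    stays-below : ∀ {r} → suc p₀' ≤ r → suc r < suc p₀ → at π r < i → at π (suc r) < i
    stays-below {r} p'≤r 1+r<p π[r]<i with <-cmp (at π (suc r)) i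
    ... | tri< π[r+1]<i _ _ = π[r+1]<i
    ... | tri≈ _ π[r+1]≡i _ = contradiction π[r+1]≡i (i-not-before (≤-pred 1+r<p))
    ... | tri> _ _ i<π[r+1] =
      contradiction (inj₂ (π[r]<π[p] , π[p]<π[p'] , π[p']<π[r+1]))
                    (π-baxter (suc p₀') r (suc p₀) (s≤s z≤n) p'<r 1+r<p p≤n)
      where
      p'<r : suc p₀' < r
      p'<r = ≤∧≢⇒< p'≤r (λ p'≡r → <-asym π[r]<i (subst (λ q → i < at π q) p'≡r (subst (i <_) (sym π[p']≡1+i) (n<1+n i))))
      π[r]<π[p] : at π r < at π (suc p₀)
      π[r]<π[p] = subst (at π r <_) (sym π[p]≡i) π[r]<i
      π[p']<π[r+1] : at π (suc p₀') < at π (suc r)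
      π[p']<π[r+1] = subst (_< at π (suc r)) (sym π[p']≡1+i)
                       (≤∧≢⇒< i<π[r+1] (λ e → 1+i-not-after (s≤s p'≤r) (sym e)))

    -- Such a descent π_{r+1} < i < i+1 < π_r, with i at p and i+1 at p', is a 2-41-3.
    no-straddle-between : ∀ {r} → suc p₀ ≤ r → suc r < suc p₀' → straddles π (suc i) (suc r) ≡ false
    no-straddle-between {r} p≤r 1+r<p' with suc i <? at π r
    ... | no ¬1+i<π[r] = straddles-below {q = suc r} (≮⇒≥ ¬1+i<π[r])
    ... | yes 1+i<π[r] with at π (suc r) <? suc i
    ...   | no ¬π[r+1]<1+i rewrite <ᵇ-false (≮⇒≥ ¬π[r+1]<1+i) = refl
    ...   | yes π[r+1]<1+i =
      contradiction (inj₁ (π[r+1]<π[p] , π[p]<π[p'] , π[p']<π[r]))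
                    (π-baxter (suc p₀) r (suc p₀') (s≤s z≤n) p<r 1+r<p' p'≤n)
      where
      p<r : suc p₀ < r
      p<r = ≤∧≢⇒< p≤r (λ p≡r → <-asym (n<1+n i) (subst (suc i <_) (trans (cong (at π) (sym p≡r)) π[p]≡i) 1+i<π[r]))
      π[r+1]<π[p] : at π (suc r) < at π (suc p₀)
      π[r+1]<π[p] = subst (at π (suc r) <_) (sym π[p]≡i)
                      (≤∧≢⇒< (≤-pred π[r+1]<1+i) (i-not-after (s≤s p≤r)))
      π[p']<π[r] : at π (suc p₀') < at π r
      π[p']<π[r] = subst (_< at π r) (sym π[p']≡1+i) 1+i<π[r]

    straddles-at-p' : straddles π i (suc p₀') ≡ false
    straddles-at-p' = trans (cong (λ x → (x <ᵇ i) ∧ (i <ᵇ at π p₀')) π[p']≡1+i)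
                         (cong (_∧ (i <ᵇ at π p₀')) (<ᵇ-false (n≤1+n i)))

    straddles-at-p : p₀ ≤ p₀' → straddles π (suc i) (suc p₀) ≡ (i <ᵇ at π p₀)
    straddles-at-p p₀≤p₀' = cong₂ _∧_ (trans (cong (_<ᵇ suc i) π[p]≡i) (<ᵇ-true (n<1+n i)))
                                   (sym (<ᵇ-sucˡ (1+i-not-before p₀≤p₀')))

    below-i-invariant : ∀ {r} → suc p₀' ≤ r → suc r < suc p₀ →
      indicator (at π r <ᵇ i) + indicator (straddles π i (suc r)) ≡ indicator (at π (suc r) <ᵇ i)
    below-i-invariant {r} p'≤r 1+r<p with <-cmp (at π r) i
    ... | tri< π[r]<i _ _
      rewrite <ᵇ-true π[r]<i | straddles-below {q = suc r} (<⇒≤ π[r]<i)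
            | <ᵇ-true (stays-below p'≤r 1+r<p π[r]<i) = refl
    ... | tri≈ _ π[r]≡i _ = contradiction π[r]≡i (i-not-before (<⇒≤ (≤-pred 1+r<p)))
    ... | tri> _ _ i<π[r] rewrite <ᵇ-false (<⇒≤ i<π[r]) | straddles-above {q = suc r} i<π[r] = refl

    crossings-from-p' : ∀ d → d + suc p₀' ≤ p₀ →
      crossings π i (d + suc p₀') ≡ crossings π i (suc p₀') + indicator (at π (d + suc p₀') <ᵇ i)
    crossings-from-p' zero _ rewrite π[p']≡1+i | <ᵇ-false (n≤1+n i) = sym (+-identityʳ _)
    crossings-from-p' (suc d) 1+r≤p₀ = begin
      crossings π i r + indicator (straddles π i (suc r))
        ≡⟨ cong (_+ indicator (straddles π i (suc r))) (crossings-from-p' d (<⇒≤ 1+r≤p₀)) ⟩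
      (crossings π i (suc p₀') + indicator (at π r <ᵇ i)) + indicator (straddles π i (suc r))
        ≡⟨ +-assoc (crossings π i (suc p₀')) _ _ ⟩
      crossings π i (suc p₀') + (indicator (at π r <ᵇ i) + indicator (straddles π i (suc r)))
        ≡⟨ cong (λ x → crossings π i (suc p₀') + x) (below-i-invariant (m≤n+m (suc p₀') d) (s≤s 1+r≤p₀)) ⟩
      crossings π i (suc p₀') + indicator (at π (suc r) <ᵇ i) ∎
      where
      open ≡-Reasoning
      r = d + suc p₀'

    crossings-from-p : ∀ d → d + suc p₀ ≤ p₀' → crossings π (suc i) (d + suc p₀) ≡ crossings π (suc i) (suc p₀)
    crossings-from-p zero _ = refl
    crossings-from-p (suc d) 1+r≤p₀' =
      trans (cong₂ _+_ (crossings-from-p d (<⇒≤ 1+r≤p₀'))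
                       (cong indicator (no-straddle-between (m≤n+m (suc p₀) d) (s≤s 1+r≤p₀'))))
            (+-identityʳ _)

    crossings-descent : p₀' < p₀ → crossings π i p₀ ≡ crossings π (suc i) p₀' + indicator (at π p₀ <ᵇ i)
    crossings-descent p'≤p₀ = begin
      crossings π i p₀
        ≡⟨ cong (crossings π i) (sym d+p'≡p₀) ⟩
      crossings π i (d + suc p₀')
        ≡⟨ crossings-from-p' d (≤-reflexive d+p'≡p₀) ⟩
      crossings π i (suc p₀') + indicator (at π (d + suc p₀') <ᵇ i)
        ≡⟨ cong₂ _+_ before-p' (cong (λ q → indicator (at π q <ᵇ i)) d+p'≡p₀) ⟩
      crossings π (suc i) p₀' + indicator (at π p₀ <ᵇ i) ∎
      where
      open ≡-Reasoning
      d = p₀ ∸ suc p₀'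
      d+p'≡p₀ : d + suc p₀' ≡ p₀
      d+p'≡p₀ = m∸n+n≡m p'≤p₀
      before-p' : crossings π i (suc p₀') ≡ crossings π (suc i) p₀'
      before-p' = begin
        crossings π i p₀' + indicator (straddles π i (suc p₀'))
          ≡⟨ cong (λ b → crossings π i p₀' + indicator b) straddles-at-p' ⟩
        crossings π i p₀' + 0
          ≡⟨ +-identityʳ _ ⟩
        crossings π i p₀'
          ≡⟨ crossings-suc p₀' (λ q≤p₀' → i-not-before (≤-trans q≤p₀' (<⇒≤ p'≤p₀)))
                               (λ q<p₀' → 1+i-not-before (<⇒≤ q<p₀')) ⟩
        crossings π (suc i) p₀' ∎

    crossings-ascent : p₀ < p₀' → crossings π (suc i) p₀' ≡ crossings π i p₀ + indicator (i <ᵇ at π p₀)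
    crossings-ascent p≤p₀' = begin
      crossings π (suc i) p₀'
        ≡⟨ cong (crossings π (suc i)) (sym d+p≡p₀') ⟩
      crossings π (suc i) (d + suc p₀)
        ≡⟨ crossings-from-p d (≤-reflexive d+p≡p₀') ⟩
      crossings π (suc i) p₀ + indicator (straddles π (suc i) (suc p₀))
        ≡⟨ cong₂ _+_ (sym (crossings-suc p₀ i-not-before (λ q<p₀ → 1+i-not-before (≤-trans (<⇒≤ q<p₀) p₀≤p₀'))))
                     (cong indicator (straddles-at-p p₀≤p₀')) ⟩
      crossings π i p₀ + indicator (i <ᵇ at π p₀) ∎
      where
      open ≡-Reasoning
      d = p₀' ∸ suc p₀
      d+p≡p₀' : d + suc p₀ ≡ p₀'
      d+p≡p₀' = m∸n+n≡m p≤p₀'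
      p₀≤p₀' : p₀ ≤ p₀'
      p₀≤p₀' = <⇒≤ p≤p₀'

    mu-i : mu π i ≡ suc (crossings π i p₀)
    mu-i = trans (mu≡ {π} i) (cong (λ q → suc (crossings π i (q ∸ 1))) pos≡p)

    mu-1+i : mu π (suc i) ≡ suc (crossings π (suc i) p₀')
    mu-1+i = trans (mu≡ {π} (suc i)) (cong (λ q → suc (crossings π (suc i) (q ∸ 1))) pos≡p')

    mu-descent : p₀' < p₀ → mu π i ≡ indicator (at π p₀ <ᵇ i) + mu π (suc i)
    mu-descent p'<p = begin
      mu π i                             ≡⟨ mu-i ⟩
      suc (crossings π i p₀)             ≡⟨ cong suc (crossings-descent p'<p) ⟩
      suc (crossings π (suc i) p₀' + below) ≡⟨ cong suc (+-comm _ below) ⟩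
      suc (below + crossings π (suc i) p₀') ≡⟨ sym (+-suc below _) ⟩
      below + suc (crossings π (suc i) p₀') ≡⟨ cong (λ x → below + x) (sym mu-1+i) ⟩
      below + mu π (suc i)               ∎
      where
      open ≡-Reasoning
      below = indicator (at π p₀ <ᵇ i)

    mu-ascent : p₀ < p₀' → mu π (suc i) ≡ indicator (i <ᵇ at π p₀) + mu π i
    mu-ascent p<p' = begin
      mu π (suc i)                  ≡⟨ mu-1+i ⟩
      suc (crossings π (suc i) p₀') ≡⟨ cong suc (crossings-ascent p<p') ⟩
      suc (crossings π i p₀ + above) ≡⟨ cong suc (+-comm _ above) ⟩
      suc (above + crossings π i p₀) ≡⟨ sym (+-suc above _) ⟩
      above + suc (crossings π i p₀) ≡⟨ cong (λ x → above + x) (sym mu-i) ⟩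
      above + mu π i                ∎
      where
      open ≡-Reasoning
      above = indicator (i <ᵇ at π p₀)

    height-bStep : height (bStep (letter π i)) ≡ indicator (at π p₀ <ᵇ i)
    height-bStep = trans (cong height (bStep-letter {π} pos≡p))
                         (trans (height-if (i <ᵇ at π p₀)) (cong indicator (not-<ᵇ (i-not-before ≤-refl))))

    balance⇔p'<p : (mu π i ≡ height (bStep (letter π i)) + mu π (suc i)) ⇔ p₀' < p₀
    balance⇔p'<p rewrite height-bStep with <-cmp p₀' p₀
    ... | tri< p'<p _ _ = mk⇔ (λ _ → p'<p) (λ _ → mu-descent p'<p)
    ... | tri≈ _ p₀'≡p₀ _ =
      contradiction (trans (sym π[p]≡i) (trans (cong (λ q → at π (suc q)) (sym p₀'≡p₀)) π[p']≡1+i)) (<⇒≢ (n<1+n i))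
    ... | tri> _ _ p<p' = mk⇔ (λ balanced → contradiction (unbalanced balanced) (<⇒≢ (n<1+n (mu π i))))
                              (λ p'<p → contradiction p'<p (<-asym p<p'))
      where
      open ≡-Reasoning
      below = indicator (at π p₀ <ᵇ i)
      above = indicator (i <ᵇ at π p₀)
      unbalanced : mu π i ≡ below + mu π (suc i) → mu π i ≡ suc (mu π i)
      unbalanced balanced = begin
        mu π i                   ≡⟨ balanced ⟩
        below + mu π (suc i)     ≡⟨ cong (λ x → below + x) (mu-ascent p<p') ⟩
        below + (above + mu π i) ≡⟨ sym (+-assoc below above _) ⟩
        (below + above) + mu π i ≡⟨ cong (_+ mu π i) (indicator-trichotomy (i-not-before ≤-refl)) ⟩
        suc (mu π i)             ∎

    p'<p⇔IDES : i < n → p₀' < p₀ ⇔ IDES n π i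
    p'<p⇔IDES i<n = mk⇔ (λ p'<p → 1≤i , i<n , subst₂ _<_ (sym pos≡p') (sym pos≡p) (s≤s p'<p))
                        (λ (_ , _ , p'<p) → ≤-pred (subst₂ _<_ pos≡p' pos≡p p'<p))

  horizontal-steps : ∀ {i} → 1 ≤ i → i < n →
      (HorizStep (bVert π) i ⇔ DB n π i)
      × (HorizStep (mVert n π) i ⇔ IDES n π i)
      × (HorizStep (tVert π) i ⇔ DThat n π i)
  horizontal-steps {suc k} 1≤i i<n
    with p₀ , π[p]≡i ← occurs 1≤i (<⇒≤ i<n) | p₀' , π[p']≡1+i ← occurs (s≤s z≤n) i<n =
    let open Occurrence 1≤i π[p]≡i
        open Adjacent 1≤i π[p]≡i π[p']≡1+i
    in prev-above⇔DB ⇔-∘ bottom-step⇔ pos≡p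
     , p'<p⇔IDES i<n ⇔-∘ (balance⇔p'<p ⇔-∘ middle-step⇔ i<n)
     , next-not-above⇔DThat i<n ⇔-∘ top-step⇔ pos≡p

lemma2p4 : (n : ℕ) (π : List ℕ) → IsPerm n π → Baxter n π →
    (i : ℕ) → 1 ≤ i → i ≤ n ∸ 1 →
      (HorizStep (bVert π) i ⇔ DB n π i)
      × (HorizStep (mVert n π) i ⇔ IDES n π i)
      × (HorizStep (tVert π) i ⇔ DThat n π i)
lemma2p4 zero _ _ _ _ (s≤s z≤n) ()
lemma2p4 (suc m) π π-perm π-baxter i 1≤i i≤m = BaxterPermutation.horizontal-steps π-perm π-baxter 1≤i (s≤s i≤m)
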